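{- In the computational $\lambda\Box$-calculus, if $\Gamma\vdash M:\tau$ and $M\to_cN$, then $\Gamma\vdash N:\tau$.
   Context: Types: $\sigma::=p\mid\sigma\supset\sigma\mid\Box\sigma$. Terms (box bodies restricted to values): $M::=c\mid x\mid\lambda x^\sigma.M\mid MM\mid\mathbf{box}_{x_1^{\sigma_1},\dots,x_n^{\sigma_n}}(M_1,\dots,M_n;V)\mid\mathrm{let}\ x=N\ \mathrm{in}\ M$. The $x_i$ are bound in the box body, and the free variables of a box term are those of the $M_i$. Typing rules: - $\Gamma\vdash c^\tau:\tau$; - $\Gamma,x:\tau,\Gamma'\vdash x:\tau$; - the usual $\lambda$ and application rules; - from $x_1:\sigma_1,\dots,x_n:\sigma_n\vdash M:\tau$ and $\Gamma\vdash N_i:\Box\sigma_i$ infer $\Gamma\vdash\mathbf{box}_{\vec x}(\vec N;M):\Box\tau$; - from $\Gamma\vdash N:\sigma$ and $\Gamma,x:\sigma\vdash M:\tau$ infer $\Gamma\vdash\mathrm{let}\ x=N\ \mathrm{in}\ M:\tau$. Values: $V::=c\mid x\mid\lambda x.M\mid\mathbf{box}_{\vec x}(V_1,\dots,V_n;M)$; a non-value is a term that is not a value. Simple evaluation contexts: $C::=[\,]M\mid V[\,]\mid\mathbf{box}_{\vec x}(V_1,\dots,V_k,[\,],M_1,\dots,M_m;M)$. $\to_c$ is the closure under term contexts of the following rules (new bound variables fresh): - $\mathrm{let}\ x=M\ \mathrm{in}\ x\to M$; - $\mathrm{let}\ x=V\ \mathrm{in}\ M\to M[x:=V]$; - $(\lambda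 x.M)V\to M[x:=V]$; - $\lambda x.Vx\to V$ ($x\notin FV(V)$); - $\mathrm{let}\ x=(\mathrm{let}\ y=L\ \mathrm{in}\ N)\ \mathrm{in}\ M\to\mathrm{let}\ y=L\ \mathrm{in}\ \mathrm{let}\ x=N\ \mathrm{in}\ M$ ($y\notin FV(M)$); - $C[A]\to\mathrm{let}\ x=A\ \mathrm{in}\ C[x]$ for $A$ a non-value; - $\mathbf{box}_x(M;x)\to M$; - $\mathbf{box}_{\vec w,x,\vec z}(\vec W,\mathbf{box}_{\vec y}(\vec N;V),\vec P;M)\to\mathbf{box}_{\vec w,\vec y,\vec z}(\vec W,\vec N,\vec P;M[x:=V])$, $\vec W$ values, $|\vec w|=|\vec W|$. -}

module Defs where

open import Data.Nat using (ℕ; zero; suc; _+_)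
open import Data.Fin using (Fin; zero; suc; _↑ˡ_; _↑ʳ_; splitAt)
open import Data.Vec using (Vec; []; _∷_; _++_; lookup)
open import Data.Vec.Relation.Unary.All using (All)
open import Data.Sum using (_⊎_; inj₁; inj₂)
open import Relation.Nullary using (¬_)

infixr 7 _⊃_
data Type : Set where
  atom : ℕ → Type
  _⊃_  : Type → Type → Type
  □_   : Type → Type

-- Well-scoped de Bruijn terms; Term n = terms with at most n free variables.
--   con c τ      : the constant c^τ (constants carry their type)
--   lam σ M      : λ x^σ. M           (x = var zero in M)
--   box Ns M     : box_{x_1..x_k}(N_1..N_k ; M), the body M lives in scope k,
--                  var i in M denotes x_{i+1}, bound to N_{i+1}
--   let′ N M     : let x = N in M     (x = var zero in M)
data Term : ℕ → Set where
  con  : ∀ {n} → ℕ → Type → Term n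
  var  : ∀ {n} → Fin n → Term n
  lam  : ∀ {n} → Type → Term (suc n) → Term n
  app  : ∀ {n} → Term n → Term n → Term n
  box  : ∀ {n k} → Vec (Term n) k → Term k → Term n
  let′ : ∀ {n} → Term n → Term (suc n) → Term n

ext : ∀ {m n} → (Fin m → Fin n) → Fin (suc m) → Fin (suc n)
ext ρ zero    = zero
ext ρ (suc i) = suc (ρ i)

mutual
  rename : ∀ {m n} → (Fin m → Fin n) → Term m → Term n
  rename ρ (con c τ)  = con c τ
  rename ρ (var i)    = var (ρ i)
  rename ρ (lam σ M)  = lam σ (rename (ext ρ) M)
  rename ρ (app M N)  = app (rename ρ M) (rename ρ N)
  rename ρ (box Ns M) = box (renames ρ Ns) M
  rename ρ (let′ N M) = let′ (rename ρ N) (rename (ext ρ) M)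

  renames : ∀ {m n k} → (Fin m → Fin n) → Vec (Term m) k → Vec (Term n) k
  renames ρ []       = []
  renames ρ (M ∷ Ms) = rename ρ M ∷ renames ρ Ms

wk : ∀ {n} → Term n → Term (suc n)
wk = rename suc

wks : ∀ {n k} → Vec (Term n) k → Vec (Term (suc n)) k
wks = renames suc

exts : ∀ {m n} → (Fin m → Term n) → Fin (suc m) → Term (suc n)
exts s zero    = var zero
exts s (suc i) = wk (s i)

mutual
  subst : ∀ {m n} → (Fin m → Term n) → Term m → Term n
  subst s (con c τ)  = con c τ
  subst s (var i)    = s i
  subst s (lam σ M)  = lam σ (subst (exts s) M)
  subst s (app M N)  = app (subst s M) (subst s N)
  subst s (box Ns M) = box (substs s Ns) M
  subst s (let′ N M) = let′ (subst s N) (subst (exts s) M)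

  substs : ∀ {m n k} → (Fin m → Term n) → Vec (Term m) k → Vec (Term n) k
  substs s []       = []
  substs s (M ∷ Ms) = subst s M ∷ substs s Ms

_[_] : ∀ {n} → Term (suc n) → Term n → Term n
M [ V ] = subst σ M
  where
    σ : Fin (suc _) → Term _
    σ zero    = V
    σ (suc i) = var i

-- Substitution used by the box-flattening rule: scope w,x,z (sizes j,1,k)
-- is mapped to scope w,y,z (sizes j,l,k), with x := V (V in scope y).
flatSub : ∀ {j l k} → Term l → Fin (j + suc k) → Term (j + (l + k))
flatSub {j} {l} {k} V i with splitAt j i
... | inj₁ a       = var (a ↑ˡ (l + k))
... | inj₂ zero    = rename (λ b → j ↑ʳ (b ↑ˡ k)) V
... | inj₂ (suc c) = var (j ↑ʳ (l ↑ʳ c))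

data Value {n : ℕ} : Term n → Set where
  v-con : ∀ {c τ} → Value (con c τ)
  v-var : ∀ {i} → Value (var i)
  v-lam : ∀ {σ M} → Value (lam σ M)
  v-box : ∀ {k} {Vs : Vec (Term n) k} {M} → All Value Vs → Value (box Vs M)

-- Terms of the calculus: box bodies are restricted to values (checked hereditarily).
data WF : ∀ {n} → Term n → Set where
  wf-con  : ∀ {n c τ} → WF {n} (con c τ)
  wf-var  : ∀ {n i} → WF {n} (var i)
  wf-lam  : ∀ {n σ} {M : Term (suc n)} → WF M → WF (lam σ M)
  wf-app  : ∀ {n} {M N : Term n} → WF M → WF N → WF (app M N)
  wf-box  : ∀ {n k} {Ns : Vec (Term n) k} {V : Term k} →
            All WF Ns → Value V → WF V → WF (box Ns V)
  wf-let  : ∀ {n} {N : Term n} {M} → WF N → WF M → WF (let′ N M)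

Ctx : ℕ → Set
Ctx n = Vec Type n

infix 4 _⊢_∶_
data _⊢_∶_ : ∀ {n} → Ctx n → Term n → Type → Set where
  ⊢con : ∀ {n} {Γ : Ctx n} {c τ} → Γ ⊢ con c τ ∶ τ
  ⊢var : ∀ {n} {Γ : Ctx n} {i} → Γ ⊢ var i ∶ lookup Γ i
  ⊢lam : ∀ {n} {Γ : Ctx n} {σ τ M} → (σ ∷ Γ) ⊢ M ∶ τ → Γ ⊢ lam σ M ∶ σ ⊃ τ
  ⊢app : ∀ {n} {Γ : Ctx n} {σ τ M N} → Γ ⊢ M ∶ σ ⊃ τ → Γ ⊢ N ∶ σ → Γ ⊢ app M N ∶ τ
  ⊢box : ∀ {n k} {Γ : Ctx n} {Δ : Ctx k} {Ns : Vec (Term n) k} {M τ} →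
         Δ ⊢ M ∶ τ → (∀ i → Γ ⊢ lookup Ns i ∶ □ (lookup Δ i)) →
         Γ ⊢ box Ns M ∶ □ τ
  ⊢let : ∀ {n} {Γ : Ctx n} {σ τ N M} → Γ ⊢ N ∶ σ → (σ ∷ Γ) ⊢ M ∶ τ →
         Γ ⊢ let′ N M ∶ τ

infix 4 _⟶_
data _⟶_ : ∀ {n} → Term n → Term n → Set where
  let-var   : ∀ {n} {M : Term n} → let′ M (var zero) ⟶ M
  let-val   : ∀ {n} {V : Term n} {M} → Value V → let′ V M ⟶ M [ V ]
  beta      : ∀ {n} {σ} {M : Term (suc n)} {V} → Value V → app (lam σ M) V ⟶ M [ V ]
  -- λx.Vx → V  (x ∉ FV(V), expressed by V being weakened)
  eta       : ∀ {n} {σ} {V : Term n} → Value V → lam σ (app (wk V) (var zero)) ⟶ V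
  -- let x = (let y = L in N) in M → let y = L in let x = N in M
  let-assoc : ∀ {n} {L : Term n} {N M} →
              let′ (let′ L N) M ⟶ let′ L (let′ N (rename (ext suc) M))
  -- C[A] → let x = A in C[x], A non-value, C simple evaluation context
  lift-appL : ∀ {n} {A M : Term n} → ¬ Value A →
              app A M ⟶ let′ A (app (var zero) (wk M))
  lift-appR : ∀ {n} {V A : Term n} → Value V → ¬ Value A →
              app V A ⟶ let′ A (app (wk V) (var zero))
  lift-box  : ∀ {n j m} {Vs : Vec (Term n) j} {A : Term n} {Ms : Vec (Term n) m}
                {M : Term (j + suc m)} → All Value Vs → ¬ Value A →
              box (Vs ++ A ∷ Ms) M ⟶ let′ A (box (wks Vs ++ var zero ∷ wks Ms) M)
  box-id    : ∀ {n} {M : Term n} → box (M ∷ []) (var zero) ⟶ M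
  -- box_{w,x,z}(W, box_y(N;V), P; M) → box_{w,y,z}(W, N, P; M[x:=V])
  box-flat  : ∀ {n j l k} {Ws : Vec (Term n) j} {Ns : Vec (Term n) l} {V : Term l}
                {Ps : Vec (Term n) k} {M : Term (j + suc k)} → All Value Ws →
              box (Ws ++ box Ns V ∷ Ps) M ⟶ box (Ws ++ Ns ++ Ps) (subst (flatSub {j} V) M)
  ξ-lam     : ∀ {n σ} {M M' : Term (suc n)} → M ⟶ M' → lam σ M ⟶ lam σ M'
  ξ-appL    : ∀ {n} {M M' N : Term n} → M ⟶ M' → app M N ⟶ app M' N
  ξ-appR    : ∀ {n} {M N N' : Term n} → N ⟶ N' → app M N ⟶ app M N'
  ξ-boxArg  : ∀ {n j m} {Ls : Vec (Term n) j} {N N' : Term n} {Ps : Vec (Term n) m}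
                {M : Term (j + suc m)} → N ⟶ N' →
              box (Ls ++ N ∷ Ps) M ⟶ box (Ls ++ N' ∷ Ps) M
  ξ-boxBody : ∀ {n k} {Ns : Vec (Term n) k} {M M' : Term k} → M ⟶ M' →
              box Ns M ⟶ box Ns M'
  ξ-letL    : ∀ {n} {N N' : Term n} {M} → N ⟶ N' → let′ N M ⟶ let′ N' M
  ξ-letR    : ∀ {n} {N : Term n} {M M'} → M ⟶ M' → let′ N M ⟶ let′ N M'

module Submission where

open import Defs
open import Data.Nat using (ℕ; _+_)
open import Data.Fin using (Fin; zero; suc; splitAt)
open import Data.Fin.Properties using (splitAt⁻¹-↑ˡ; splitAt⁻¹-↑ʳ)
open import Data.Vec using (Vec; []; _∷_; _++_; lookup)
import Data.Vec as Vec
open import Data.Vec.Properties using (lookup-++ˡ; lookup-++ʳ)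
open import Data.Vec.Relation.Binary.Pointwise.Inductive as Pointwise
  using (Pointwise; []; _∷_; ++⁺; ++⁻)
open import Data.Vec.Relation.Binary.Pointwise.Extensional
  using (extensional⇒inductive) renaming (ext to pointwise-ext)
open import Data.Sum using (inj₁; inj₂)
open import Data.Product using (Σ-syntax; _×_; _,_)
open import Relation.Binary.PropositionalEquality
  using (_≡_; refl; sym; trans) renaming (subst to transport)

retype : ∀ {n} {Γ : Ctx n} {M σ τ} → σ ≡ τ → Γ ⊢ M ∶ σ → Γ ⊢ M ∶ τ
retype {Γ = Γ} {M} = transport (λ τ → Γ ⊢ M ∶ τ)

var-typed : ∀ {n} {Γ : Ctx n} {i τ} → lookup Γ i ≡ τ → Γ ⊢ var i ∶ τ
var-typed eq = retype eq ⊢var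

lookup-renames : ∀ {m n k} (ρ : Fin m → Fin n) (Ns : Vec (Term m) k) i →
  lookup (renames ρ Ns) i ≡ rename ρ (lookup Ns i)
lookup-renames ρ (N ∷ Ns) zero    = refl
lookup-renames ρ (N ∷ Ns) (suc i) = lookup-renames ρ Ns i

lookup-substs : ∀ {m n k} (s : Fin m → Term n) (Ns : Vec (Term m) k) i →
  lookup (substs s Ns) i ≡ subst s (lookup Ns i)
lookup-substs s (N ∷ Ns) zero    = refl
lookup-substs s (N ∷ Ns) (suc i) = lookup-substs s Ns i

infix 4 _∶_⇒ʳ_
_∶_⇒ʳ_ : ∀ {m n} → (Fin m → Fin n) → Ctx m → Ctx n → Set
ρ ∶ Γ ⇒ʳ Δ = ∀ i → lookup Δ (ρ i) ≡ lookup Γ i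

ext-typed : ∀ {m n} {Γ : Ctx m} {Δ : Ctx n} {ρ σ} →
  ρ ∶ Γ ⇒ʳ Δ → ext ρ ∶ (σ ∷ Γ) ⇒ʳ (σ ∷ Δ)
ext-typed h zero    = refl
ext-typed h (suc i) = h i

rename-typed : ∀ {m n} {Γ : Ctx m} {Δ : Ctx n} {ρ} →
  ρ ∶ Γ ⇒ʳ Δ → ∀ {M τ} → Γ ⊢ M ∶ τ → Δ ⊢ rename ρ M ∶ τ
rename-typed h ⊢con                  = ⊢con
rename-typed h (⊢var {i = i})        = var-typed (h i)
rename-typed h (⊢lam d)              = ⊢lam (rename-typed (ext-typed h) d)
rename-typed h (⊢app d e)            = ⊢app (rename-typed h d) (rename-typed h e)
rename-typed {ρ = ρ} h (⊢box {Ns = Ns} d hs) =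
  ⊢box d (λ i → transport (λ N → _ ⊢ N ∶ _) (sym (lookup-renames ρ Ns i))
                          (rename-typed h (hs i)))
rename-typed h (⊢let d e)            = ⊢let (rename-typed h d) (rename-typed (ext-typed h) e)

weaken : ∀ {n} {Γ : Ctx n} {σ M τ} → Γ ⊢ M ∶ τ → (σ ∷ Γ) ⊢ wk M ∶ τ
weaken = rename-typed (λ i → refl)

mutual
  unrename-typed : ∀ {m n} {Γ : Ctx m} {Δ : Ctx n} {ρ} →
    ρ ∶ Γ ⇒ʳ Δ → ∀ M {τ} → Δ ⊢ rename ρ M ∶ τ → Γ ⊢ M ∶ τ
  unrename-typed h (con c τ)  ⊢con       = ⊢con
  unrename-typed h (var i)    ⊢var       = var-typed (sym (h i))
  unrename-typed h (lam σ M)  (⊢lam d)   = ⊢lam (unrename-typed (ext-typed h) M d)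
  unrename-typed h (app M N)  (⊢app d e) = ⊢app (unrename-typed h M d) (unrename-typed h N e)
  unrename-typed h (box Ns M) (⊢box {Δ = Θ} d hs) = ⊢box d (unrename-args h Ns Θ hs)
  unrename-typed h (let′ N M) (⊢let d e) =
    ⊢let (unrename-typed h N d) (unrename-typed (ext-typed h) M e)

  unrename-args : ∀ {m n k} {Γ : Ctx m} {Δ : Ctx n} {ρ} → ρ ∶ Γ ⇒ʳ Δ →
    (Ns : Vec (Term m) k) (Θ : Ctx k) →
    (∀ i → Δ ⊢ lookup (renames ρ Ns) i ∶ □ lookup Θ i) →
    ∀ i → Γ ⊢ lookup Ns i ∶ □ lookup Θ i
  unrename-args h (N ∷ Ns) (σ ∷ Θ) hs zero    = unrename-typed h N (hs zero)
  unrename-args h (N ∷ Ns) (σ ∷ Θ) hs (suc i) = unrename-args h Ns Θ (λ j → hs (suc j)) i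

strengthen : ∀ {n} {Γ : Ctx n} {σ M τ} → (σ ∷ Γ) ⊢ wk M ∶ τ → Γ ⊢ M ∶ τ
strengthen {M = M} = unrename-typed (λ i → refl) M

infix 4 _∶_⇒ˢ_
_∶_⇒ˢ_ : ∀ {m n} → (Fin m → Term n) → Ctx m → Ctx n → Set
s ∶ Γ ⇒ˢ Δ = ∀ i → Δ ⊢ s i ∶ lookup Γ i

exts-typed : ∀ {m n} {Γ : Ctx m} {Δ : Ctx n} {s σ} →
  s ∶ Γ ⇒ˢ Δ → exts s ∶ (σ ∷ Γ) ⇒ˢ (σ ∷ Δ)
exts-typed h zero    = ⊢var
exts-typed h (suc i) = weaken (h i)

subst-typed : ∀ {m n} {Γ : Ctx m} {Δ : Ctx n} {s} →
  s ∶ Γ ⇒ˢ Δ → ∀ {M τ} → Γ ⊢ M ∶ τ → Δ ⊢ subst s M ∶ τ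
subst-typed h ⊢con           = ⊢con
subst-typed h (⊢var {i = i}) = h i
subst-typed h (⊢lam d)       = ⊢lam (subst-typed (exts-typed h) d)
subst-typed h (⊢app d e)     = ⊢app (subst-typed h d) (subst-typed h e)
subst-typed {s = s} h (⊢box {Ns = Ns} d hs) =
  ⊢box d (λ i → transport (λ N → _ ⊢ N ∶ _) (sym (lookup-substs s Ns i))
                          (subst-typed h (hs i)))
subst-typed h (⊢let d e)     = ⊢let (subst-typed h d) (subst-typed (exts-typed h) e)

subst-zero-typed : ∀ {n} {Γ : Ctx n} {σ τ M V} →
  (σ ∷ Γ) ⊢ M ∶ τ → Γ ⊢ V ∶ σ → Γ ⊢ M [ V ] ∶ τ
subst-zero-typed d e = subst-typed (λ { zero → e ; (suc i) → ⊢var }) d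

flatSub-typed : ∀ {j l k} (Δ₁ : Ctx j) (Δ' : Ctx l) (Δ₂ : Ctx k) {ρ V} →
  Δ' ⊢ V ∶ ρ → flatSub {j} V ∶ (Δ₁ ++ ρ ∷ Δ₂) ⇒ˢ (Δ₁ ++ Δ' ++ Δ₂)
flatSub-typed {j} Δ₁ Δ' Δ₂ {ρ} dV i with splitAt j i in eq
... | inj₁ a rewrite sym (splitAt⁻¹-↑ˡ eq) =
  var-typed (trans (lookup-++ˡ Δ₁ (Δ' ++ Δ₂) a) (sym (lookup-++ˡ Δ₁ (ρ ∷ Δ₂) a)))
... | inj₂ zero rewrite sym (splitAt⁻¹-↑ʳ eq) | lookup-++ʳ Δ₁ (ρ ∷ Δ₂) zero =
  rename-typed (λ b → trans (lookup-++ʳ Δ₁ (Δ' ++ Δ₂) _) (lookup-++ˡ Δ' Δ₂ b)) dV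
... | inj₂ (suc c) rewrite sym (splitAt⁻¹-↑ʳ eq) =
  var-typed (trans (trans (lookup-++ʳ Δ₁ (Δ' ++ Δ₂) _) (lookup-++ʳ Δ' Δ₂ c))
                   (sym (lookup-++ʳ Δ₁ (ρ ∷ Δ₂) (suc c))))

Args : ∀ {n k} → Ctx n → Vec (Term n) k → Ctx k → Set
Args Γ = Pointwise (λ N σ → Γ ⊢ N ∶ □ σ)

⊢box-args : ∀ {n k} {Γ : Ctx n} {Θ : Ctx k} {Ns M τ} →
  Θ ⊢ M ∶ τ → Args Γ Ns Θ → Γ ⊢ box Ns M ∶ □ τ
⊢box-args d as = ⊢box d (Pointwise.lookup as)

args : ∀ {n k} {Γ : Ctx n} {Θ : Ctx k} {Ns : Vec (Term n) k} →
  (∀ i → Γ ⊢ lookup Ns i ∶ □ lookup Θ i) → Args Γ Ns Θ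
args hs = extensional⇒inductive (pointwise-ext hs)

split-args : ∀ {n j m} {Γ : Ctx n} (Ls : Vec (Term n) j) {Ps : Vec (Term n) m}
  {Θ : Ctx (j + m)} → Args Γ (Ls ++ Ps) Θ →
  Σ[ Θ₁ ∈ Ctx j ] Σ[ Θ₂ ∈ Ctx m ] Θ ≡ Θ₁ ++ Θ₂ × Args Γ Ls Θ₁ × Args Γ Ps Θ₂
split-args {j = j} Ls {Θ = Θ} as with Vec.splitAt j Θ
... | Θ₁ , Θ₂ , refl with ++⁻ Ls Θ₁ as
...   | as₁ , as₂ = Θ₁ , Θ₂ , refl , as₁ , as₂

weaken-args : ∀ {n k} {Γ : Ctx n} {σ} {Ns : Vec (Term n) k} {Θ} →
  Args Γ Ns Θ → Args (σ ∷ Γ) (wks Ns) Θ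
weaken-args []       = []
weaken-args (d ∷ as) = weaken d ∷ weaken-args as

-- Each contraction rule is an instance of one of the lemmas above: β and
-- let-value are substitution, η is strengthening, let-associativity and the
-- lifting rules are renaming, and the box rules split the argument typings
-- around the argument they act on.
preservation : ∀ {n} {Γ : Ctx n} {M N : Term n} {τ} → Γ ⊢ M ∶ τ → M ⟶ N → Γ ⊢ N ∶ τ
preservation (⊢let d ⊢var)          let-var        = d
preservation (⊢let d e)             (let-val _)    = subst-zero-typed e d
preservation (⊢app (⊢lam d) e)      (beta _)       = subst-zero-typed d e
preservation (⊢lam (⊢app d ⊢var))   (eta _)        = strengthen d
preservation (⊢let (⊢let d₁ d₂) e)  let-assoc      =
  ⊢let d₁ (⊢let d₂ (rename-typed (ext-typed (λ i → refl)) e))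
preservation (⊢app d e)             (lift-appL _)   = ⊢let d (⊢app ⊢var (weaken e))
preservation (⊢app d e)             (lift-appR _ _) = ⊢let e (⊢app (weaken d) ⊢var)
preservation (⊢box {Δ = Θ} d hs) (lift-box {Vs = Vs} _ _) with split-args Vs (args {Θ = Θ} hs)
... | _ , _ , refl , as₁ , dA ∷ as₂ =
  ⊢let dA (⊢box-args d (++⁺ (weaken-args as₁) (⊢var ∷ weaken-args as₂)))
preservation (⊢box ⊢var hs)         box-id         = hs zero
preservation (⊢box {Δ = Θ} d hs) (box-flat {Ws = Ws} _) with split-args Ws (args {Θ = Θ} hs)
... | Θ₁ , _ , refl , as₁ , ⊢box {Δ = Δ'} dV hs' ∷ as₂ =
  ⊢box-args (subst-typed (flatSub-typed Θ₁ Δ' _ dV) d) (++⁺ as₁ (++⁺ (args hs') as₂))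
preservation (⊢lam d)               (ξ-lam r)      = ⊢lam (preservation d r)
preservation (⊢app d e)             (ξ-appL r)     = ⊢app (preservation d r) e
preservation (⊢app d e)             (ξ-appR r)     = ⊢app d (preservation e r)
preservation (⊢box {Δ = Θ} d hs) (ξ-boxArg {Ls = Ls} r) with split-args Ls (args {Θ = Θ} hs)
... | _ , _ , refl , as₁ , dN ∷ as₂ = ⊢box-args d (++⁺ as₁ (preservation dN r ∷ as₂))
preservation (⊢box d hs)            (ξ-boxBody r)  = ⊢box (preservation d r) hs
preservation (⊢let d e)             (ξ-letL r)     = ⊢let (preservation d r) e
preservation (⊢let d e)             (ξ-letR r)     = ⊢let d (preservation e r)

proposition9 : ∀ {n : ℕ} {Γ : Ctx n} {M N : Term n} {τ : Type} →
    WF M → Γ ⊢ M ∶ τ → M ⟶ N → Γ ⊢ N ∶ τ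
proposition9 _ = preservation
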